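{- Let $m,n\in\mathbb{N}$ satisfy $m\leq n-1$. Let $\mathfrak{G}=(G_1,\ldots,G_m)$ be a graph collection on $[n]$ with $\delta(\mathfrak{G})\geq m$. Let $T$ be a tree with $m$ edges, and let $t\in V(T)$ and $v\in[n]$. Then $\mathfrak{G}$ contains a rainbow copy of $T$ in which $t$ is copied to $v$.
   Context: A graph collection on $[n]$ is a finite sequence of (not necessarily distinct) graphs each with vertex set $[n]$; $\delta(\mathfrak{G})=\min_i\delta(G_i)$. A rainbow copy of $T$ in $\mathfrak{G}$ is a copy of $T$ in $\bigcup_iG_i$ together with an assignment to each of its edges $e$ of an index (colour) $i$ with $e\in E(G_i)$, distinct edges receiving distinct colours. -}

module Defs where

open import Data.Nat using (ℕ; zero; suc; _+_; _≤_; _∸_; _<ᵇ_)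
open import Data.Bool using (Bool; true; false; if_then_else_; _∧_)
open import Data.Fin using (Fin; toℕ; inject₁; fromℕ) renaming (zero to fzero; suc to fsuc)
open import Data.List using (List; map; allFin)
open import Data.Nat.ListAction using (sum)
open import Data.Product using (Σ; _×_; _,_)
open import Function.Definitions using (Injective)
open import Relation.Binary.PropositionalEquality using (_≡_)
open import Relation.Nullary using (¬_)

record Graph (n : ℕ) : Set where
  field
    adj   : Fin n → Fin n → Bool
    sym   : ∀ u w → adj u w ≡ adj w u
    irrefl : ∀ u → adj u u ≡ false
open Graph public

degree : ∀ {n} → Graph n → Fin n → ℕ
degree {n} G u = sum (map (λ w → if adj G u w then 1 else 0) (allFin n))

edgeCount : ∀ {k} → Graph k → ℕ
edgeCount {k} G =
  sum (map (λ i → sum (map (λ j → if (toℕ i <ᵇ toℕ j) ∧ adj G i j then 1 else 0)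
                           (allFin k)))
           (allFin k))

data Reach {k : ℕ} (G : Graph k) : Fin k → Fin k → Set where
  here : ∀ {a} → Reach G a a
  step : ∀ {a c b} → adj G a c ≡ true → Reach G c b → Reach G a b

Connected : ∀ {k} → Graph k → Set
Connected G = ∀ a b → Reach G a b

-- A cycle of length l + 3: distinct vertices f 0, …, f (l+2),
-- consecutive ones adjacent and f (l+2) adjacent to f 0.
record Cycle {k : ℕ} (G : Graph k) : Set where
  field
    len     : ℕ
    vert    : Fin (suc (suc (suc len))) → Fin k
    distinct : Injective _≡_ _≡_ vert
    consec  : ∀ (i : Fin (suc (suc len))) → adj G (vert (inject₁ i)) (vert (fsuc i)) ≡ true
    closing : adj G (vert (fromℕ (suc (suc len)))) (vert fzero) ≡ true

Acyclic : ∀ {k} → Graph k → Set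
Acyclic G = ¬ Cycle G

IsTree : ∀ {k} → Graph k → Set
IsTree G = Connected G × Acyclic G

MinDegColl≥ : ∀ {m n} → (Fin m → Graph n) → ℕ → Set
MinDegColl≥ {m} {n} 𝔊 d = ∀ (i : Fin m) (u : Fin n) → d ≤ degree (𝔊 i) u

record RainbowCopy {m n k : ℕ} (𝔊 : Fin m → Graph n) (T : Graph k)
                   (t : Fin k) (v : Fin n) : Set where
  field
    φ        : Fin k → Fin n
    φ-inj    : Injective _≡_ _≡_ φ
    φ-t      : φ t ≡ v
    colour   : ∀ a b → toℕ a Data.Nat.< toℕ b → adj T a b ≡ true → Fin m
    colour-inj : ∀ a b a' b' (p : toℕ a Data.Nat.< toℕ b) (e : adj T a b ≡ true)
                   (p' : toℕ a' Data.Nat.< toℕ b') (e' : adj T a' b' ≡ true) →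
                   colour a b p e ≡ colour a' b' p' e' → (a ≡ a') × (b ≡ b')
    colour-ok : ∀ a b (p : toℕ a Data.Nat.< toℕ b) (e : adj T a b ≡ true) →
                   adj (𝔊 (colour a b p e)) (φ a) (φ b) ≡ true

{-# OPTIONS --safe #-}
-- List the vertices of T as t = x₀, x₁, …, x_{k−1} so that every x_y with y > 0 has an earlier
-- neighbour x_{p(y)}; such an ordering exhausts T because T is connected. The pairs {x_{p(y)}, x_y}
-- are k − 1 distinct edges, so k ≤ m + 1, and as T is acyclic, p(y) is the only earlier neighbour
-- of x_y, so these are all the edges of T. Now embed greedily: x₀ goes to v, and x_y goes to a
-- neighbour of the image of x_{p(y)} in G_y that is not yet used. This is possible since G_y has
-- minimum degree m ≥ y while only y vertices are used, one of them being that image itself. The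
-- edge {x_{p(y)}, x_y} gets colour y, so the copy is rainbow.
module Submission where

open import Defs renaming (sym to adj-sym; irrefl to adj-irrefl)
open import Data.Bool using (true; if_then_else_; _∧_; T) renaming (_≟_ to _≟ᵇ_)
open import Data.Bool.Properties using (T-≡; T-∧)
open import Data.Empty using (⊥; ⊥-elim)
open import Data.Fin using (Fin; toℕ; fromℕ<; inject₁; fromℕ) renaming (zero to fzero; suc to fsuc)
open import Data.Fin.Properties using (any?; pigeonhole; toℕ<n; toℕ-fromℕ<; toℕ-injective)
  renaming (_≟_ to _≟ᶠ_)
open import Data.List using (List; []; _∷_; map; tabulate; allFin)
open import Data.List.Membership.Propositional using (_∈_; _∉_)
open import Data.List.Relation.Unary.Any using (here; there)
import Data.Nat.ListAction as List
open import Data.Nat using (ℕ; zero; suc; _+_; _≤_; _<_; _∸_; z≤n; s≤s; _<?_; _≤?_; _<ᵇ_)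
open import Data.Nat.Induction using (<-rec)
open import Data.Nat.Properties
open import Algebra.Properties.CommutativeMonoid.Sum +-0-commutativeMonoid
  using (sum-syntax; sum-cong-≗; sum-replicate-zero; ∑-distrib-+; ∑-comm)
open import Data.Product using (Σ; ∃-syntax; _×_; _,_; proj₁; proj₂)
open import Data.Sum using (_⊎_; inj₁; inj₂; [_,_]′)
open import Data.Unit using (⊤; tt)
open import Function using (_∘_; Equivalence)
open import Relation.Binary.Definitions using (tri<; tri≈; tri>)
open import Relation.Binary.PropositionalEquality
open import Relation.Nullary using (¬_; Dec; yes; no; does; ¬?; _×-dec_; T?)
import Relation.Nullary.Decidable as Dec
open import Relation.Nullary.Decidable using (decidable-stable)

𝟙 : {P : Set} → Dec P → ℕ
𝟙 p = if does p then 1 else 0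

𝟙-cong : {P Q : Set} (p : Dec P) (q : Dec Q) → (P → Q) → (Q → P) → 𝟙 p ≡ 𝟙 q
𝟙-cong (yes _) (yes _) _ _ = refl
𝟙-cong (no _)  (no _)  _ _ = refl
𝟙-cong (yes p) (no ¬q) f _ = ⊥-elim (¬q (f p))
𝟙-cong (no ¬p) (yes q) _ g = ⊥-elim (¬p (g q))

𝟙-≤ : {P : Set} {n : ℕ} (p : Dec P) → (P → 1 ≤ n) → 𝟙 p ≤ n
𝟙-≤ (yes p) P⇒1≤n = P⇒1≤n p
𝟙-≤ (no _)  _     = z≤n

𝟙-≤-+ : {P Q R : Set} (p : Dec P) (q : Dec Q) (r : Dec R) →
        (P → Q ⊎ R) → 𝟙 p ≤ 𝟙 q + 𝟙 r
𝟙-≤-+ (no _)  _       _       _ = z≤n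
𝟙-≤-+ (yes _) (yes _) _       _ = s≤s z≤n
𝟙-≤-+ (yes _) (no _)  (yes _) _ = ≤-refl
𝟙-≤-+ (yes p) (no ¬q) (no ¬r) f = [ ⊥-elim ∘ ¬q , ⊥-elim ∘ ¬r ]′ (f p)

𝟙-+-≤ : {P Q R : Set} (p : Dec P) (q : Dec Q) (r : Dec R) →
        (P → Q → ⊥) → (P → R) → (Q → R) → 𝟙 p + 𝟙 q ≤ 𝟙 r
𝟙-+-≤ (yes p) (yes q) _       disj _   _   = ⊥-elim (disj p q)
𝟙-+-≤ (no _)  (no _)  _       _    _   _   = z≤n
𝟙-+-≤ (yes _) (no _)  (yes _) _    _   _   = ≤-refl
𝟙-+-≤ (no _)  (yes _) (yes _) _    _   _   = ≤-refl
𝟙-+-≤ (yes p) (no _)  (no ¬r) _    p⇒r _   = ⊥-elim (¬r (p⇒r p))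
𝟙-+-≤ (no _)  (yes q) (no ¬r) _    _   q⇒r = ⊥-elim (¬r (q⇒r q))

∑-tabulate : ∀ {A : Set} n (g : Fin n → A) (f : A → ℕ) →
             List.sum (map f (tabulate g)) ≡ ∑[ i < n ] f (g i)
∑-tabulate zero    g f = refl
∑-tabulate (suc n) g f = cong (f (g fzero) +_) (∑-tabulate n (g ∘ fsuc) f)

∑-allFin : ∀ n (f : Fin n → ℕ) → List.sum (map f (allFin n)) ≡ ∑[ i < n ] f i
∑-allFin n f = ∑-tabulate n (λ i → i) f

∑-mono-≤ : ∀ {n} {f g : Fin n → ℕ} →
           (∀ i → f i ≤ g i) → ∑[ i < n ] f i ≤ ∑[ i < n ] g i
∑-mono-≤ {zero}  _   = z≤n
∑-mono-≤ {suc n} f≤g = +-mono-≤ (f≤g fzero) (∑-mono-≤ (f≤g ∘ fsuc))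

∑-const-1 : ∀ n → ∑[ i < n ] 1 ≡ n
∑-const-1 zero    = refl
∑-const-1 (suc n) = cong suc (∑-const-1 n)

∑-𝟙-≟ : ∀ {n} (c : Fin n) → ∑[ i < n ] 𝟙 (i ≟ᶠ c) ≡ 1
∑-𝟙-≟ {suc n} fzero    = cong suc (sum-replicate-zero n)
∑-𝟙-≟ {suc n} (fsuc c) = ∑-𝟙-≟ c

InjectiveBelow : {A : Set} → ℕ → (ℕ → A) → Set
InjectiveBelow s f = ∀ {x y} → x < s → y < s → f x ≡ f y → x ≡ y

InImage : {A : Set} → (ℕ → A) → ℕ → A → Set
InImage f s a = ∃[ x ] x < s × f x ≡ a

∃<? : {P : ℕ → Set} → (∀ x → Dec (P x)) → ∀ s → Dec (∃[ x ] x < s × P x)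
∃<? {P} P? s = Dec.map′ (λ (i , p) → toℕ i , toℕ<n i , p)
                        (λ (x , x<s , p) → fromℕ< x<s , subst P (sym (toℕ-fromℕ< x<s)) p)
                        (any? (P? ∘ toℕ))

inImage? : ∀ {n} (f : ℕ → Fin n) s u → Dec (InImage f s u)
inImage? f s u = ∃<? (λ x → f x ≟ᶠ u) s

snocAt : {A : Set} → (ℕ → A) → ℕ → A → ℕ → A
snocAt f s a x with x <? s
... | yes _ = f x
... | no _  = a

module _ {A : Set} {f : ℕ → A} {s : ℕ} {a : A} where

  snocAt-< : ∀ {x} → x < s → snocAt f s a x ≡ f x
  snocAt-< {x} x<s with x <? s
  ... | yes _   = refl
  ... | no x≮s = ⊥-elim (x≮s x<s)

  snocAt-≡ : snocAt f s a s ≡ a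
  snocAt-≡ with s <? s
  ... | yes s<s = ⊥-elim (<-irrefl refl s<s)
  ... | no _    = refl

  snocAt-injective : InjectiveBelow s f → ¬ InImage f s a → InjectiveBelow (suc s) (snocAt f s a)
  snocAt-injective inj a∉f {x} {y} x<1+s y<1+s eq
    with m<1+n⇒m<n∨m≡n x<1+s | m<1+n⇒m<n∨m≡n y<1+s
  ... | inj₂ refl | inj₂ refl = refl
  ... | inj₁ x<s  | inj₁ y<s  = inj x<s y<s (trans (sym (snocAt-< x<s)) (trans eq (snocAt-< y<s)))
  ... | inj₁ x<s  | inj₂ refl = ⊥-elim (a∉f (x , x<s , trans (sym (snocAt-< x<s)) (trans eq snocAt-≡)))
  ... | inj₂ refl | inj₁ y<s  =
    ⊥-elim (a∉f (y , y<s , trans (sym (snocAt-< y<s)) (trans (sym eq) snocAt-≡)))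

InjectiveBelow⇒≤ : ∀ {k s} {f : ℕ → Fin k} → InjectiveBelow s f → s ≤ k
InjectiveBelow⇒≤ {k} {s} {f} inj with s ≤? k
... | yes s≤k = s≤k
... | no s≰k with pigeonhole (≰⇒> s≰k) (f ∘ toℕ)
...   | i , j , i<j , fi≡fj = ⊥-elim (<⇒≢ i<j (inj (toℕ<n i) (toℕ<n j) fi≡fj))

∑-InImage≤ : ∀ {n} (f : ℕ → Fin n) s → ∑[ u < n ] 𝟙 (inImage? f s u) ≤ s
∑-InImage≤ {n} f zero = ≤-trans (∑-mono-≤ none) (≤-reflexive (sum-replicate-zero n))
  where
  none : ∀ u → 𝟙 (inImage? f zero u) ≤ 0
  none u = 𝟙-≤ (inImage? f zero u) λ { (_ , () , _) }
∑-InImage≤ {n} f (suc s) = begin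
  ∑[ u < n ] 𝟙 (inImage? f (suc s) u)
    ≤⟨ ∑-mono-≤ split ⟩
  ∑[ u < n ] (𝟙 (u ≟ᶠ f s) + 𝟙 (inImage? f s u))
    ≡⟨ ∑-distrib-+ (λ u → 𝟙 (u ≟ᶠ f s)) (λ u → 𝟙 (inImage? f s u)) ⟩
  ∑[ u < n ] 𝟙 (u ≟ᶠ f s) + ∑[ u < n ] 𝟙 (inImage? f s u)
    ≡⟨ cong (_+ ∑[ u < n ] 𝟙 (inImage? f s u)) (∑-𝟙-≟ (f s)) ⟩
  suc (∑[ u < n ] 𝟙 (inImage? f s u))
    ≤⟨ s≤s (∑-InImage≤ f s) ⟩
  suc s
    ∎
  where
  open ≤-Reasoning
  split : ∀ u → 𝟙 (inImage? f (suc s) u) ≤ 𝟙 (u ≟ᶠ f s) + 𝟙 (inImage? f s u)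
  split u = 𝟙-≤-+ (inImage? f (suc s) u) (u ≟ᶠ f s) (inImage? f s u) last-or-earlier
    where
    last-or-earlier : InImage f (suc s) u → u ≡ f s ⊎ InImage f s u
    last-or-earlier (x , x<1+s , fx≡u) with m<1+n⇒m<n∨m≡n x<1+s
    ... | inj₁ x<s  = inj₂ (x , x<s , fx≡u)
    ... | inj₂ refl = inj₁ (sym fx≡u)

∑∑-distrib-+ : ∀ {k} (f g : Fin k → Fin k → ℕ) →
               ∑[ a < k ] ∑[ b < k ] (f a b + g a b) ≡
               ∑[ a < k ] ∑[ b < k ] f a b + ∑[ a < k ] ∑[ b < k ] g a b
∑∑-distrib-+ {k} f g = trans (sum-cong-≗ (λ a → ∑-distrib-+ (f a) (g a)))
                             (∑-distrib-+ (λ a → ∑[ b < k ] f a b) (λ a → ∑[ b < k ] g a b))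

-- w and its ≥ s neighbours are more than s vertices, so not all occur among f 0, …, f (s ∸ 1).
fresh-neighbour : ∀ {n} (G : Graph n) (f : ℕ → Fin n) {s w} →
                  InImage f s w → s ≤ degree G w → ∃[ u ] adj G w u ≡ true × ¬ InImage f s u
fresh-neighbour {n} G f {s} {w} w∈f s≤deg with any? (λ u → T? (adj G w u) ×-dec ¬? (inImage? f s u))
... | yes (u , wu , u∉f) = u , Equivalence.to T-≡ wu , u∉f
... | no none = ⊥-elim (<-irrefl refl (≤-trans (s≤s s≤deg) crowded))
  where
  open ≤-Reasoning
  N : Fin n → ℕ
  N u = 𝟙 (T? (adj G w u))
  covered : ∀ u → N u + 𝟙 (u ≟ᶠ w) ≤ 𝟙 (inImage? f s u)
  covered u = 𝟙-+-≤ (T? (adj G w u)) (u ≟ᶠ w) (inImage? f s u) loop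
                (λ wu → decidable-stable (inImage? f s u) (λ u∉f → none (u , wu , u∉f)))
                (λ { refl → w∈f })
    where
    loop : T (adj G w u) → u ≡ w → ⊥
    loop wu refl = subst T (adj-irrefl G w) wu
  crowded : suc (degree G w) ≤ s
  crowded = begin
    suc (degree G w)                          ≡⟨ cong suc (∑-allFin n N) ⟩
    suc (∑[ u < n ] N u)                      ≡⟨ +-comm 1 _ ⟩
    ∑[ u < n ] N u + 1                        ≡⟨ cong (∑[ u < n ] N u +_) (sym (∑-𝟙-≟ w)) ⟩
    ∑[ u < n ] N u + ∑[ u < n ] 𝟙 (u ≟ᶠ w)    ≡⟨ sym (∑-distrib-+ N (λ u → 𝟙 (u ≟ᶠ w))) ⟩
    ∑[ u < n ] (N u + 𝟙 (u ≟ᶠ w))             ≤⟨ ∑-mono-≤ covered ⟩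
    ∑[ u < n ] 𝟙 (inImage? f s u)             ≤⟨ ∑-InImage≤ f s ⟩
    s                                         ∎

edgeCount-∑ : ∀ {k} (G : Graph k) →
              edgeCount G ≡ ∑[ a < k ] ∑[ b < k ] 𝟙 (T? ((toℕ a <ᵇ toℕ b) ∧ adj G a b))
edgeCount-∑ {k} G =
  trans (∑-allFin k _) (sum-cong-≗ (λ a → ∑-allFin k (λ b → 𝟙 (T? ((toℕ a <ᵇ toℕ b) ∧ adj G a b)))))

-- edgeCount counts each edge once, smaller endpoint first; by asymmetry R hits each edge at most once.
∑∑𝟙-asym⊆adj≤edgeCount : ∀ {k} (G : Graph k) {R : Fin k → Fin k → Set} →
                          (R? : ∀ a b → Dec (R a b)) → (∀ {a b} → R a b → ¬ R b a) →
                          (∀ {a b} → R a b → adj G a b ≡ true) →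
                          ∑[ a < k ] ∑[ b < k ] 𝟙 (R? a b) ≤ edgeCount G
∑∑𝟙-asym⊆adj≤edgeCount {k} G {R} R? asym R⊆adj = begin
  ∑[ a < k ] ∑[ b < k ] 𝟙 (R? a b)
    ≤⟨ ∑-mono-≤ (λ a → ∑-mono-≤ (λ b → 𝟙-≤-+ (R? a b) (up? a b) (down? a b) oriented)) ⟩
  ∑[ a < k ] ∑[ b < k ] (Up a b + Down a b)
    ≡⟨ ∑∑-distrib-+ Up Down ⟩
  ∑[ a < k ] ∑[ b < k ] Up a b + ∑[ a < k ] ∑[ b < k ] Down a b
    ≡⟨ cong (∑[ a < k ] ∑[ b < k ] Up a b +_) (∑-comm Down) ⟩
  ∑[ a < k ] ∑[ b < k ] Up a b + ∑[ a < k ] ∑[ b < k ] Down b a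
    ≡⟨ sym (∑∑-distrib-+ Up (λ a b → Down b a)) ⟩
  ∑[ a < k ] ∑[ b < k ] (Up a b + Down b a)
    ≤⟨ ∑-mono-≤ (λ a → ∑-mono-≤ (λ b → 𝟙-+-≤ (up? a b) (down? b a) (T? _) disjoint
                                              (λ (a<b , r) → edge a<b (R⊆adj r))
                                              (λ (a<b , r) → edge a<b (trans (adj-sym G _ _) (R⊆adj r))))) ⟩
  ∑[ a < k ] ∑[ b < k ] 𝟙 (T? ((toℕ a <ᵇ toℕ b) ∧ adj G a b))
    ≡⟨ sym (edgeCount-∑ G) ⟩
  edgeCount G
    ∎
  where
  open ≤-Reasoning
  up? : ∀ a b → Dec (toℕ a < toℕ b × R a b)
  up? a b = toℕ a <? toℕ b ×-dec R? a b
  down? : ∀ a b → Dec (toℕ b < toℕ a × R a b)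
  down? a b = toℕ b <? toℕ a ×-dec R? a b
  Up Down : Fin k → Fin k → ℕ
  Up a b   = 𝟙 (up? a b)
  Down a b = 𝟙 (down? a b)
  oriented : ∀ {a b} → R a b → (toℕ a < toℕ b × R a b) ⊎ (toℕ b < toℕ a × R a b)
  oriented {a} {b} r with <-cmp (toℕ a) (toℕ b)
  ... | tri< a<b _ _ = inj₁ (a<b , r)
  ... | tri> _ _ b<a = inj₂ (b<a , r)
  ... | tri≈ _ a≡b _ with toℕ-injective a≡b
  ...   | refl = ⊥-elim (asym r r)
  disjoint : ∀ {a b} → toℕ a < toℕ b × R a b → toℕ a < toℕ b × R b a → ⊥
  disjoint (_ , r) (_ , r′) = asym r r′
  edge : ∀ {a b} → toℕ a < toℕ b → adj G a b ≡ true → T ((toℕ a <ᵇ toℕ b) ∧ adj G a b)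
  edge a<b ab = Equivalence.from T-∧ (<⇒<ᵇ a<b , Equivalence.from T-≡ ab)

module _ {k : ℕ} (G : Graph k) (root : Fin k) where

  record Enumeration : Set where
    field
      size             : ℕ
      vertex           : ℕ → Fin k
      parent           : ℕ → ℕ
      nonempty         : 0 < size
      vertex-root      : vertex 0 ≡ root
      vertex-injective : InjectiveBelow size vertex
      parent-<         : ∀ {y} → 0 < y → y < size → parent y < y
      parent-adj       : ∀ {y} → 0 < y → y < size → adj G (vertex (parent y)) (vertex y) ≡ true

  open Enumeration

  Enumerated : Enumeration → Fin k → Set
  Enumerated e = InImage (vertex e) (size e)

  Candidate : Enumeration → Fin k → Set
  Candidate e c = ¬ Enumerated e c × ∃[ x ] x < size e × adj G (vertex e x) c ≡ true

  Maximal : Enumeration → Set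
  Maximal e = ∀ c → ¬ Candidate e c

  size≤ : (e : Enumeration) → size e ≤ k
  size≤ e = InjectiveBelow⇒≤ (vertex-injective e)

  singleton : Enumeration
  singleton = record
    { size = 1 ; vertex = λ _ → root ; parent = λ _ → 0
    ; nonempty = s≤s z≤n ; vertex-root = refl
    ; vertex-injective = λ { (s≤s z≤n) (s≤s z≤n) _ → refl }
    ; parent-< = λ { 0<y (s≤s y≤0) → ⊥-elim (<⇒≱ 0<y y≤0) }
    ; parent-adj = λ { 0<y (s≤s y≤0) → ⊥-elim (<⇒≱ 0<y y≤0) } }

  extend : (e : Enumeration) {c : Fin k} → Candidate e c → Enumeration
  extend e {c} (c∉e , x , x<s , xc) = record
    { size = suc (size e) ; vertex = snocAt (vertex e) (size e) c ; parent = snocAt (parent e) (size e) x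
    ; nonempty = s≤s z≤n ; vertex-root = trans (snocAt-< (nonempty e)) (vertex-root e)
    ; vertex-injective = snocAt-injective (vertex-injective e) c∉e
    ; parent-< = parent-<′ ; parent-adj = parent-adj′ }
    where
    parent-<′ : ∀ {y} → 0 < y → y < suc (size e) → snocAt (parent e) (size e) x y < y
    parent-<′ 0<y y<1+s with m<1+n⇒m<n∨m≡n y<1+s
    ... | inj₁ y<s  rewrite snocAt-< {f = parent e} {a = x} y<s = parent-< e 0<y y<s
    ... | inj₂ refl rewrite snocAt-≡ {f = parent e} {s = size e} {a = x} = x<s
    parent-adj′ : ∀ {y} → 0 < y → y < suc (size e) →
                  adj G (snocAt (vertex e) (size e) c (snocAt (parent e) (size e) x y))
                        (snocAt (vertex e) (size e) c y) ≡ true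
    parent-adj′ 0<y y<1+s with m<1+n⇒m<n∨m≡n y<1+s
    ... | inj₁ y<s  rewrite snocAt-< {f = parent e} {a = x} y<s
                          | snocAt-< {f = vertex e} {a = c} (<-trans (parent-< e 0<y y<s) y<s)
                          | snocAt-< {f = vertex e} {a = c} y<s = parent-adj e 0<y y<s
    ... | inj₂ refl rewrite snocAt-≡ {f = parent e} {s = size e} {a = x}
                          | snocAt-≡ {f = vertex e} {s = size e} {a = c}
                          | snocAt-< {f = vertex e} {a = c} x<s = xc

  candidate? : (e : Enumeration) → ∀ c → Dec (Candidate e c)
  candidate? e c = ¬? (inImage? (vertex e) (size e) c)
                   ×-dec ∃<? (λ x → adj G (vertex e x) c ≟ᵇ true) (size e)

  grow : (fuel : ℕ) (e : Enumeration) → k ≤ size e + fuel → Σ Enumeration Maximal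
  grow fuel e k≤ with any? (candidate? e)
  ... | no none = e , λ c cand → none (c , cand)
  grow zero e k≤ | yes (c , cand) =
    ⊥-elim (<-irrefl refl (≤-trans (size≤ (extend e cand)) (subst (k ≤_) (+-identityʳ _) k≤)))
  grow (suc fuel) e k≤ | yes (c , cand) =
    grow fuel (extend e cand) (subst (k ≤_) (+-suc _ fuel) k≤)

  maximal : Σ Enumeration Maximal
  maximal = grow k singleton (m≤n+m k 1)

  Maximal⇒spanning : Connected G → (e : Enumeration) → Maximal e → ∀ b → Enumerated e b
  Maximal⇒spanning connected e max b = go (connected root b) (0 , nonempty e , vertex-root e)
    where
    go : ∀ {a b} → Reach G a b → Enumerated e a → Enumerated e b
    go here a∈e = a∈e
    go (step {c = c} ac c⇝b) (x , x<s , refl) with inImage? (vertex e) (size e) c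
    ... | yes c∈e = go c⇝b c∈e
    ... | no c∉e  = ⊥-elim (max c (c∉e , x , x<s , ac))

module Walks {k : ℕ} (G : Graph k) where

  open import Data.List.Membership.DecPropositional (_≟ᶠ_ {k}) using (_∈?_)

  data Walk (Q : Fin k → Set) : Fin k → Fin k → Set where
    nil  : ∀ {a} → Q a → Walk Q a a
    cons : ∀ {a b c} → Q a → adj G a b ≡ true → Walk Q b c → Walk Q a c

  map-Walk : ∀ {Q Q′ : Fin k → Set} → (∀ {x} → Q x → Q′ x) →
             ∀ {a b} → Walk Q a b → Walk Q′ a b
  map-Walk f (nil q)       = nil (f q)
  map-Walk f (cons q ab w) = cons (f q) ab (map-Walk f w)

  module _ {Q : Fin k → Set} where

    vertices : ∀ {a b} → Walk Q a b → List (Fin k)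
    vertices (nil {a} _)      = a ∷ []
    vertices (cons {a} _ _ w) = a ∷ vertices w

    IsPath : ∀ {a b} → Walk Q a b → Set
    IsPath (nil _)          = ⊤
    IsPath (cons {a} _ _ w) = a ∉ vertices w × IsPath w

    ∈-vertices⇒Q : ∀ {a b x} (w : Walk Q a b) → x ∈ vertices w → Q x
    ∈-vertices⇒Q (nil q)      (here refl) = q
    ∈-vertices⇒Q (cons q _ _) (here refl) = q
    ∈-vertices⇒Q (cons _ _ w) (there x∈w) = ∈-vertices⇒Q w x∈w

    first-Q : ∀ {a b} → Walk Q a b → Q a
    first-Q (nil q)      = q
    first-Q (cons q _ _) = q

    _++_ : ∀ {a b c} → Walk Q a b → Walk Q b c → Walk Q a c
    nil _       ++ w′ = w′
    cons q ab w ++ w′ = cons q ab (w ++ w′)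

    reverse : ∀ {a b} → Walk Q a b → Walk Q b a
    reverse (nil q)               = nil q
    reverse (cons {a} {b} q ab w) = reverse w ++ cons (first-Q w) (trans (adj-sym G b a) ab) (nil q)

    dropUntil : ∀ {a b c} (w : Walk Q b c) → IsPath w → a ∈ vertices w → Σ (Walk Q a c) IsPath
    dropUntil (nil q)       _         (here refl) = nil q , tt
    dropUntil (cons q ab w) path      (here refl) = cons q ab w , path
    dropUntil (cons _ _ w)  (_ , path) (there a∈w) = dropUntil w path a∈w

    loopErase : ∀ {a b} → Walk Q a b → Σ (Walk Q a b) IsPath
    loopErase (nil q) = nil q , tt
    loopErase (cons {a} q ab w) with loopErase w
    ... | w′ , path with a ∈? vertices w′
    ...   | yes a∈w′ = dropUntil w′ path a∈w′
    ...   | no a∉w′  = cons q ab w′ , a∉w′ , path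

    length : ∀ {a b} → Walk Q a b → ℕ
    length (nil _)      = zero
    length (cons _ _ w) = suc (length w)

    vertexAt : ∀ {a b} (w : Walk Q a b) → Fin (suc (length w)) → Fin k
    vertexAt (nil {a} _)      _        = a
    vertexAt (cons {a} _ _ w) fzero    = a
    vertexAt (cons _ _ w)     (fsuc i) = vertexAt w i

    vertexAt-∈ : ∀ {a b} (w : Walk Q a b) i → vertexAt w i ∈ vertices w
    vertexAt-∈ (nil _)      fzero    = here refl
    vertexAt-∈ (cons _ _ w) fzero    = here refl
    vertexAt-∈ (cons _ _ w) (fsuc i) = there (vertexAt-∈ w i)

    vertexAt-first : ∀ {a b} (w : Walk Q a b) → vertexAt w fzero ≡ a
    vertexAt-first (nil _)      = refl
    vertexAt-first (cons _ _ _) = refl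

    vertexAt-last : ∀ {a b} (w : Walk Q a b) → vertexAt w (fromℕ (length w)) ≡ b
    vertexAt-last (nil _)      = refl
    vertexAt-last (cons _ _ w) = vertexAt-last w

    vertexAt-adj : ∀ {a b} (w : Walk Q a b) (i : Fin (length w)) →
                   adj G (vertexAt w (inject₁ i)) (vertexAt w (fsuc i)) ≡ true
    vertexAt-adj (cons _ ab w) fzero    = subst (λ z → adj G _ z ≡ true) (sym (vertexAt-first w)) ab
    vertexAt-adj (cons _ _ w)  (fsuc i) = vertexAt-adj w i

    vertexAt-injective : ∀ {a b} (w : Walk Q a b) → IsPath w →
                         ∀ {i j} → vertexAt w i ≡ vertexAt w j → i ≡ j
    vertexAt-injective (nil _)      _          {fzero}  {fzero}  _  = refl
    vertexAt-injective (cons _ _ w) _          {fzero}  {fzero}  _  = refl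
    vertexAt-injective (cons _ _ w) (a∉w , _)  {fzero}  {fsuc j} eq =
      ⊥-elim (a∉w (subst (_∈ vertices w) (sym eq) (vertexAt-∈ w j)))
    vertexAt-injective (cons _ _ w) (a∉w , _)  {fsuc i} {fzero}  eq =
      ⊥-elim (a∉w (subst (_∈ vertices w) eq (vertexAt-∈ w i)))
    vertexAt-injective (cons _ _ w) (_ , path) {fsuc i} {fsuc j} eq =
      cong fsuc (vertexAt-injective w path eq)

    path+apex⇒Cycle : ∀ {a b c} (w : Walk Q a b) → IsPath w → a ≢ b → c ∉ vertices w →
                      adj G c a ≡ true → adj G b c ≡ true → Cycle G
    path+apex⇒Cycle (nil _) _ a≢b _ _ _ = ⊥-elim (a≢b refl)
    path+apex⇒Cycle {c = c} w@(cons _ _ w′) path _ c∉w ca bc = record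
      { len = length w′ ; vert = vert ; distinct = distinct ; consec = consec ; closing = closing }
      where
      vert : Fin (suc (suc (suc (length w′)))) → Fin k
      vert fzero    = c
      vert (fsuc i) = vertexAt w i
      distinct : ∀ {i j} → vert i ≡ vert j → i ≡ j
      distinct {fzero}  {fzero}  _  = refl
      distinct {fzero}  {fsuc j} eq = ⊥-elim (c∉w (subst (_∈ vertices w) (sym eq) (vertexAt-∈ w j)))
      distinct {fsuc i} {fzero}  eq = ⊥-elim (c∉w (subst (_∈ vertices w) eq (vertexAt-∈ w i)))
      distinct {fsuc i} {fsuc j} eq = cong fsuc (vertexAt-injective w path eq)
      consec : ∀ i → adj G (vert (inject₁ i)) (vert (fsuc i)) ≡ true
      consec fzero    = ca
      consec (fsuc i) = vertexAt-adj w i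
      closing : adj G (vert (fromℕ (suc (suc (length w′))))) c ≡ true
      closing = subst (λ z → adj G z c ≡ true) (sym (vertexAt-last w)) bc

    walk+apex⇒Cycle : ∀ {a b c} → (∀ {x} → Q x → x ≢ c) → Walk Q a b → a ≢ b →
                      adj G c a ≡ true → adj G b c ≡ true → Cycle G
    walk+apex⇒Cycle Q⇒≢c w a≢b ca bc with loopErase w
    ... | w′ , path =
      path+apex⇒Cycle w′ path a≢b (λ c∈w′ → Q⇒≢c (∈-vertices⇒Q w′ c∈w′) refl) ca bc

module _ {k : ℕ} {G : Graph k} {root : Fin k} (e : Enumeration G root) where

  open Enumeration e
  open Walks G

  pathToRoot : ∀ y → y < size → Walk (InImage vertex (suc y)) (vertex y) root
  pathToRoot = <-rec _ climb
    where
    climb : ∀ y → (∀ {z} → z < y → z < size → Walk (InImage vertex (suc z)) (vertex z) root) →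
            y < size → Walk (InImage vertex (suc y)) (vertex y) root
    climb zero    _       _   = subst (Walk _ (vertex 0)) vertex-root (nil (0 , s≤s z≤n , refl))
    climb (suc y) ancestor y<s =
      cons (suc y , ≤-refl , refl) (trans (adj-sym G _ _) (parent-adj (s≤s z≤n) y<s))
           (map-Walk widen (ancestor p<y (<-trans p<y y<s)))
      where
      p<y : parent (suc y) < suc y
      p<y = parent-< (s≤s z≤n) y<s
      widen : ∀ {a} → InImage vertex (suc (parent (suc y))) a → InImage vertex (suc (suc y)) a
      widen (x , x≤p , refl) = x , ≤-trans x≤p (m≤n⇒m≤1+n p<y) , refl

  -- Otherwise the paths from x and from parent y down to the root, closed up through y, contain a cycle.
  earlier-neighbour≡parent : Acyclic G → ∀ {x y} → x < y → y < size →
                             adj G (vertex x) (vertex y) ≡ true → x ≡ parent y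
  earlier-neighbour≡parent acyclic {x} {y} x<y y<s xy with x ≟ parent y
  ... | yes x≡p = x≡p
  ... | no x≢p  = ⊥-elim (acyclic (walk+apex⇒Cycle avoids-y detour ends-differ
                                      (trans (adj-sym G _ _) xy) (parent-adj 0<y y<s)))
    where
    0<y : 0 < y
    0<y = ≤-<-trans z≤n x<y
    p<y : parent y < y
    p<y = parent-< 0<y y<s
    narrow : ∀ {z} → z < y → ∀ {a} → InImage vertex (suc z) a → InImage vertex y a
    narrow z<y (x′ , x′≤z , eq) = x′ , ≤-<-trans (≤-pred x′≤z) z<y , eq
    detour : Walk (InImage vertex y) (vertex x) (vertex (parent y))
    detour = map-Walk (narrow x<y) (pathToRoot x (<-trans x<y y<s))
             ++ reverse (map-Walk (narrow p<y) (pathToRoot (parent y) (<-trans p<y y<s)))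
    avoids-y : ∀ {a} → InImage vertex y a → a ≢ vertex y
    avoids-y (x′ , x′<y , refl) eq = <⇒≢ x′<y (vertex-injective (<-trans x′<y y<s) y<s eq)
    ends-differ : vertex x ≢ vertex (parent y)
    ends-differ eq = x≢p (vertex-injective (<-trans x<y y<s) (<-trans p<y y<s) eq)

module Spanning {k : ℕ} {G : Graph k} {root : Fin k} (e : Enumeration G root)
                (spanning : ∀ b → Enumerated G root e b) where

  open Enumeration e

  position : Fin k → ℕ
  position b = proj₁ (spanning b)

  position-< : ∀ b → position b < size
  position-< b = proj₁ (proj₂ (spanning b))

  vertex-position : ∀ b → vertex (position b) ≡ b
  vertex-position b = proj₂ (proj₂ (spanning b))

  position-vertex : ∀ {x} → x < size → position (vertex x) ≡ x
  position-vertex x<s = vertex-injective (position-< _) x<s (vertex-position _)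

  position-injective : ∀ {a b} → position a ≡ position b → a ≡ b
  position-injective {a} {b} eq =
    trans (sym (vertex-position a)) (trans (cong vertex eq) (vertex-position b))

  position-root : position root ≡ 0
  position-root = trans (cong position (sym vertex-root)) (position-vertex nonempty)

  IsParentOf : Fin k → Fin k → Set
  IsParentOf a b = 0 < position b × parent (position b) ≡ position a

  isParentOf? : ∀ a b → Dec (IsParentOf a b)
  isParentOf? a b = 0 <? position b ×-dec parent (position b) ≟ position a

  IsParentOf⇒< : ∀ {a b} → IsParentOf a b → position a < position b
  IsParentOf⇒< {b = b} (0<p , p≡) = subst (_< position b) p≡ (parent-< 0<p (position-< b))

  IsParentOf⇒adj : ∀ {a b} → IsParentOf a b → adj G a b ≡ true
  IsParentOf⇒adj {a} {b} (0<p , p≡) =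
    subst₂ (λ u w → adj G u w ≡ true) (trans (cong vertex p≡) (vertex-position a)) (vertex-position b)
           (parent-adj 0<p (position-< b))

  IsParentOf-functional : ∀ {a a′ b} → IsParentOf a b → IsParentOf a′ b → a ≡ a′
  IsParentOf-functional (_ , p≡) (_ , p≡′) = position-injective (trans (sym p≡) p≡′)

  ∑-parents : ∀ {b} → 0 < position b → ∑[ a < k ] 𝟙 (isParentOf? a b) ≡ 1
  ∑-parents {b} 0<p =
    trans (sum-cong-≗ (λ a → 𝟙-cong (isParentOf? a b) (a ≟ᶠ p) (to a) (from a))) (∑-𝟙-≟ p)
    where
    p : Fin k
    p = vertex (parent (position b))
    to : ∀ a → IsParentOf a b → a ≡ p
    to a (_ , p≡) = trans (sym (vertex-position a)) (cong vertex (sym p≡))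
    from : ∀ a → a ≡ p → IsParentOf a b
    from a refl = 0<p , sym (position-vertex (<-trans (parent-< 0<p (position-< b)) (position-< b)))

  nonroot-or-root : ∀ b → 0 < position b ⊎ b ≡ root
  nonroot-or-root b with position b in eq
  ... | suc _ = inj₁ (s≤s z≤n)
  ... | zero  = inj₂ (trans (sym (vertex-position b)) (trans (cong vertex eq) vertex-root))

  -- Every non-root vertex has exactly one parent, and parent pairs form an asymmetric subrelation of adjacency.
  k≤1+edgeCount : k ≤ suc (edgeCount G)
  k≤1+edgeCount = begin
    k
      ≡⟨ sym (∑-const-1 k) ⟩
    ∑[ b < k ] 1
      ≤⟨ ∑-mono-≤ (λ b → 𝟙-≤-+ (yes tt) (0 <? position b) (b ≟ᶠ root) (λ _ → nonroot-or-root b)) ⟩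
    ∑[ b < k ] (NonRoot b + 𝟙 (b ≟ᶠ root))
      ≡⟨ ∑-distrib-+ NonRoot (λ b → 𝟙 (b ≟ᶠ root)) ⟩
    ∑[ b < k ] NonRoot b + ∑[ b < k ] 𝟙 (b ≟ᶠ root)
      ≡⟨ cong (∑[ b < k ] NonRoot b +_) (∑-𝟙-≟ root) ⟩
    ∑[ b < k ] NonRoot b + 1
      ≤⟨ +-monoˡ-≤ 1 (∑-mono-≤ (λ b → 𝟙-≤ (0 <? position b) (≤-reflexive ∘ sym ∘ ∑-parents))) ⟩
    ∑[ b < k ] ∑[ a < k ] 𝟙 (isParentOf? a b) + 1
      ≡⟨ cong (_+ 1) (∑-comm (λ b a → 𝟙 (isParentOf? a b))) ⟩
    ∑[ a < k ] ∑[ b < k ] 𝟙 (isParentOf? a b) + 1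
      ≤⟨ +-monoˡ-≤ 1 (∑∑𝟙-asym⊆adj≤edgeCount G isParentOf? asym IsParentOf⇒adj) ⟩
    edgeCount G + 1
      ≡⟨ +-comm _ 1 ⟩
    suc (edgeCount G)
      ∎
    where
    open ≤-Reasoning
    NonRoot : Fin k → ℕ
    NonRoot b = 𝟙 (0 <? position b)
    asym : ∀ {a b} → IsParentOf a b → ¬ IsParentOf b a
    asym ab ba = <-asym (IsParentOf⇒< ab) (IsParentOf⇒< ba)

  adj-at-positions : ∀ {a b} → adj G a b ≡ true →
                     adj G (vertex (position a)) (vertex (position b)) ≡ true
  adj-at-positions {a} {b} =
    subst₂ (λ u w → adj G u w ≡ true) (sym (vertex-position a)) (sym (vertex-position b))

  tree-edge : Acyclic G → ∀ {a b} → adj G a b ≡ true → IsParentOf a b ⊎ IsParentOf b a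
  tree-edge acyclic {a} {b} ab with <-cmp (position a) (position b)
  ... | tri< pa<pb _ _ = inj₁ (≤-<-trans z≤n pa<pb , sym (earlier-neighbour≡parent e acyclic pa<pb
                                                            (position-< b) (adj-at-positions ab)))
  ... | tri> _ _ pb<pa = inj₂ (≤-<-trans z≤n pb<pa , sym (earlier-neighbour≡parent e acyclic pb<pa
                                                            (position-< a) (adj-at-positions ba)))
    where
    ba : adj G b a ≡ true
    ba = trans (adj-sym G b a) ab
  ... | tri≈ _ pa≡pb _ with position-injective pa≡pb
  ...   | refl with trans (sym ab) (adj-irrefl G a)
  ...     | ()

connected⇒≤1+edgeCount : ∀ {k} {G : Graph k} → Connected G → Fin k → k ≤ suc (edgeCount G)
connected⇒≤1+edgeCount {G = G} connected t with maximal G t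
... | e , max = Spanning.k≤1+edgeCount e (Maximal⇒spanning G t connected e max)

module GreedyEmbedding {m n : ℕ} (𝔊 : Fin m → Graph n) (min-degree : MinDegColl≥ 𝔊 m) (v : Fin n)
                       {s : ℕ} (s≤1+m : s ≤ suc m)
                       (parent : ℕ → ℕ) (parent-< : ∀ {y} → 0 < y → y < s → parent y < y) where

  -- The vertex at position 1 + y is attached along an edge of colour y.
  colour : ∀ {y} → 0 < y → y < s → Fin m
  colour {suc y} _ y<s = fromℕ< (≤-pred (≤-trans y<s s≤1+m))

  colour-injective : ∀ {y y′} (0<y : 0 < y) (y<s : y < s) (0<y′ : 0 < y′) (y′<s : y′ < s) →
                     colour 0<y y<s ≡ colour 0<y′ y′<s → y ≡ y′
  colour-injective {suc y} {suc y′} _ y<s _ y′<s eq = cong suc (begin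
    y                         ≡⟨ toℕ-fromℕ< (≤-pred (≤-trans y<s s≤1+m)) ⟨
    toℕ (colour (s≤s z≤n) y<s)  ≡⟨ cong toℕ eq ⟩
    toℕ (colour (s≤s z≤n) y′<s) ≡⟨ toℕ-fromℕ< (≤-pred (≤-trans y′<s s≤1+m)) ⟩
    y′                        ∎)
    where open ≡-Reasoning

  record RainbowEmbedding (c : ℕ) : Set where
    field
      ψ           : ℕ → Fin n
      ψ-root      : ψ 0 ≡ v
      ψ-injective : InjectiveBelow c ψ
      ψ-adj       : ∀ {y} (0<y : 0 < y) (y<s : y < s) → y < c →
                      adj (𝔊 (colour 0<y y<s)) (ψ (parent y)) (ψ y) ≡ true

  embed : ∀ c → c < s → RainbowEmbedding (suc c)
  embed zero _ = record
    { ψ = λ _ → v ; ψ-root = refl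
    ; ψ-injective = λ { (s≤s z≤n) (s≤s z≤n) _ → refl }
    ; ψ-adj = λ { 0<y _ (s≤s y≤0) → ⊥-elim (<⇒≱ 0<y y≤0) } }
  embed (suc c) 1+c<s = record
    { ψ = snocAt ψ (suc c) u
    ; ψ-root = trans (snocAt-< {f = ψ} {s = suc c} {a = u} (s≤s z≤n)) ψ-root
    ; ψ-injective = snocAt-injective ψ-injective u-fresh
    ; ψ-adj = ψ-adj′ }
    where
    open RainbowEmbedding (embed c (≤-trans (n≤1+n _) 1+c<s))
    p<1+c : parent (suc c) < suc c
    p<1+c = parent-< (s≤s z≤n) 1+c<s
    κ : Fin m
    κ = colour (s≤s z≤n) 1+c<s
    fresh : ∃[ u ] adj (𝔊 κ) (ψ (parent (suc c))) u ≡ true × ¬ InImage ψ (suc c) u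
    fresh = fresh-neighbour (𝔊 κ) ψ (parent (suc c) , p<1+c , refl)
              (≤-trans (≤-pred (≤-trans 1+c<s s≤1+m)) (min-degree κ (ψ (parent (suc c)))))
    u : Fin n
    u = proj₁ fresh
    u-fresh : ¬ InImage ψ (suc c) u
    u-fresh = proj₂ (proj₂ fresh)
    ψ-adj′ : ∀ {y} (0<y : 0 < y) (y<s : y < s) → y < suc (suc c) →
             adj (𝔊 (colour 0<y y<s)) (snocAt ψ (suc c) u (parent y)) (snocAt ψ (suc c) u y) ≡ true
    ψ-adj′ {y} 0<y y<s y<2+c with m<1+n⇒m<n∨m≡n y<2+c
    ... | inj₁ y<1+c rewrite snocAt-< {f = ψ} {a = u} y<1+c
                           | snocAt-< {f = ψ} {a = u} (<-trans (parent-< 0<y y<s) y<1+c) =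
      ψ-adj 0<y y<s y<1+c
    ... | inj₂ refl  rewrite snocAt-≡ {f = ψ} {s = suc c} {a = u}
                           | snocAt-< {f = ψ} {a = u} p<1+c = proj₁ (proj₂ fresh)

  embedding : 0 < s → RainbowEmbedding s
  embedding (s≤s {n = c} z≤n) = embed c ≤-refl

ordered-pair-≡ : ∀ {k} {a b a′ b′ : Fin k} → toℕ a < toℕ b → toℕ a′ < toℕ b′ →
                 (a ≡ a′ × b ≡ b′) ⊎ (a ≡ b′ × b ≡ a′) → a ≡ a′ × b ≡ b′
ordered-pair-≡ _   _     (inj₁ same)      = same
ordered-pair-≡ a<b a′<b′ (inj₂ (refl , refl)) = ⊥-elim (<-asym a<b a′<b′)

module _ {m n k : ℕ} (𝔊 : Fin m → Graph n) (min-degree : MinDegColl≥ 𝔊 m)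
         {T : Graph k} (tree : IsTree T) (k≤1+m : k ≤ suc m) (t : Fin k) (v : Fin n) where

  private
    enumeration : Enumeration T t
    enumeration = proj₁ (maximal T t)
    open Enumeration enumeration
    open Spanning enumeration (Maximal⇒spanning T t (proj₁ tree) enumeration (proj₂ (maximal T t)))
    open GreedyEmbedding 𝔊 min-degree v (≤-trans (size≤ T t enumeration) k≤1+m) parent parent-<
    open RainbowEmbedding (embedding nonempty)

    φ : Fin k → Fin n
    φ a = ψ (position a)

    child-colour : ∀ {a b} → IsParentOf a b → Fin m
    child-colour {b = b} (0<p , _) = colour 0<p (position-< b)

    child-colour-adj : ∀ {a b} (ab : IsParentOf a b) → adj (𝔊 (child-colour ab)) (φ a) (φ b) ≡ true
    child-colour-adj {b = b} ab@(0<p , p≡) =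
      subst (λ x → adj (𝔊 (child-colour ab)) (ψ x) (φ b) ≡ true) p≡
            (ψ-adj 0<p (position-< b) (position-< b))

    child-colour-injective : ∀ {a b a′ b′} (ab : IsParentOf a b) (a′b′ : IsParentOf a′ b′) →
                             child-colour ab ≡ child-colour a′b′ → a ≡ a′ × b ≡ b′
    child-colour-injective {b = b} {b′ = b′} ab@(0<p , _) a′b′@(0<p′ , _) eq
      with position-injective (colour-injective 0<p (position-< b) 0<p′ (position-< b′) eq)
    ... | refl = IsParentOf-functional ab a′b′ , refl

    edge-colour : ∀ {a b} → IsParentOf a b ⊎ IsParentOf b a → Fin m
    edge-colour = [ child-colour , child-colour ]′

    edge-colour-adj : ∀ {a b} (x : IsParentOf a b ⊎ IsParentOf b a) →
                      adj (𝔊 (edge-colour x)) (φ a) (φ b) ≡ true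
    edge-colour-adj (inj₁ ab) = child-colour-adj ab
    edge-colour-adj {a} {b} (inj₂ ba) =
      trans (adj-sym (𝔊 (child-colour ba)) (φ a) (φ b)) (child-colour-adj ba)

    edge-colour-injective : ∀ {a b a′ b′} (x : IsParentOf a b ⊎ IsParentOf b a)
                            (y : IsParentOf a′ b′ ⊎ IsParentOf b′ a′) →
                            edge-colour x ≡ edge-colour y →
                            (a ≡ a′ × b ≡ b′) ⊎ (a ≡ b′ × b ≡ a′)
    edge-colour-injective (inj₁ x) (inj₁ y) eq = inj₁ (child-colour-injective x y eq)
    edge-colour-injective (inj₂ x) (inj₂ y) eq with child-colour-injective x y eq
    ... | refl , refl = inj₁ (refl , refl)
    edge-colour-injective (inj₁ x) (inj₂ y) eq = inj₂ (child-colour-injective x y eq)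
    edge-colour-injective (inj₂ x) (inj₁ y) eq with child-colour-injective x y eq
    ... | refl , refl = inj₂ (refl , refl)

  rainbow-tree : RainbowCopy 𝔊 T t v
  rainbow-tree = record
    { φ = φ
    ; φ-inj = λ eq → position-injective (ψ-injective (position-< _) (position-< _) eq)
    ; φ-t = trans (cong ψ position-root) ψ-root
    ; colour = λ _ _ _ ab → edge-colour (tree-edge (proj₂ tree) ab)
    ; colour-inj = λ _ _ _ _ a<b ab a′<b′ a′b′ eq → ordered-pair-≡ a<b a′<b′
        (edge-colour-injective (tree-edge (proj₂ tree) ab) (tree-edge (proj₂ tree) a′b′) eq)
    ; colour-ok = λ _ _ _ ab → edge-colour-adj (tree-edge (proj₂ tree) ab) }

lemma4p9 : (m n : ℕ) → m ≤ n ∸ 1 →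
    (𝔊 : Fin m → Graph n) → MinDegColl≥ 𝔊 m →
    (k : ℕ) (T : Graph k) → IsTree T → edgeCount T ≡ m →
    (t : Fin k) (v : Fin n) → RainbowCopy 𝔊 T t v
lemma4p9 m n _ 𝔊 min-degree k T tree edges≡m t v = rainbow-tree 𝔊 min-degree tree k≤1+m t v
  where
  k≤1+m : k ≤ suc m
  k≤1+m = subst (λ e → k ≤ suc e) edges≡m (connected⇒≤1+edgeCount (proj₁ tree) t)
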